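{- Let $q$ be a prime power, $n\ge 2$, and let $U\subsetneq \mathbb{F}_{q^n}$ be an $\mathbb{F}_q$-vector space of dimension $d_U\ge 2$. Then either $\omega(G_U)=q^{d_U}$ or $\omega(G_U)\le q^{d_U-1}+1$.
   Context: For an $\mathbb{F}_q$-vector subspace $U\subsetneq \mathbb{F}_{q^n}$, $G_U$ is the undirected graph with vertex set $\mathbb{F}_{q^n}$ in which distinct $a,b$ are adjacent if and only if $ab\in U$; $d_U$ is the $\mathbb{F}_q$-dimension of $U$ and $\omega(G_U)$ is the clique number of $G_U$. -}

module Defs where

open import Data.Nat using (ℕ; zero; suc; _≤_)
open import Data.Fin using (Fin)
open import Data.Fin.Subset using (Subset; _∈_; _∉_; ∣_∣)
open import Data.Product using (Σ; ∃; _×_)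
open import Relation.Binary.PropositionalEquality using (_≡_; _≢_)
open import Relation.Nullary using (¬_)
open import Algebra.Core using (Op₁; Op₂)
open import Algebra.Structures using (IsCommutativeRing)

-- A finite field with N elements, presented (w.l.o.g.) on the carrier Fin N
-- with propositional equality.
record FiniteField (N : ℕ) : Set where
  infixl 7 _*_
  infixl 6 _+_
  field
    _+_ _*_ : Op₂ (Fin N)
    -_      : Op₁ (Fin N)
    0# 1#   : Fin N
    isCommutativeRing : IsCommutativeRing _≡_ _+_ _*_ -_ 0# 1#
    0≢1     : 0# ≢ 1#
    inverse : ∀ x → x ≢ 0# → ∃ λ y → x * y ≡ 1#

module _ {N : ℕ} (L : FiniteField N) where
  open FiniteField L

  record IsSubfield (K : Subset N) : Set where
    field
      0∈K : 0# ∈ K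
      1∈K : 1# ∈ K
      +-closed : ∀ {x y} → x ∈ K → y ∈ K → (x + y) ∈ K
      *-closed : ∀ {x y} → x ∈ K → y ∈ K → (x * y) ∈ K
      neg-closed : ∀ {x} → x ∈ K → (- x) ∈ K
      inv-closed : ∀ {x y} → x ∈ K → x * y ≡ 1# → y ∈ K

  record IsSubspace (K U : Subset N) : Set where
    field
      0∈U : 0# ∈ U
      +-closed : ∀ {x y} → x ∈ U → y ∈ U → (x + y) ∈ U
      smul-closed : ∀ {c x} → c ∈ K → x ∈ U → (c * x) ∈ U

  lincomb : (d : ℕ) → (Fin d → Fin N) → (Fin d → Fin N) → Fin N
  lincomb zero    c b = 0#
  lincomb (suc d) c b = c Fin.zero * b Fin.zero
                        + lincomb d (λ i → c (Fin.suc i)) (λ i → b (Fin.suc i))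

  record IsBasis (K U : Subset N) (d : ℕ) (b : Fin d → Fin N) : Set where
    field
      in-U : ∀ i → b i ∈ U
      independent : ∀ (c : Fin d → Fin N) → (∀ i → c i ∈ K) →
                    lincomb d c b ≡ 0# → ∀ i → c i ≡ 0#
      spanning : ∀ u → u ∈ U →
                 ∃ λ (c : Fin d → Fin N) → (∀ i → c i ∈ K) × u ≡ lincomb d c b

  HasDim : (K U : Subset N) → ℕ → Set
  HasDim K U d = ∃ λ (b : Fin d → Fin N) → IsBasis K U d b

  -- Graph G_U: distinct a, b adjacent iff a * b ∈ U
  Adj : Subset N → Fin N → Fin N → Set
  Adj U a b = a ≢ b × (a * b) ∈ U

  IsClique : Subset N → Subset N → Set
  IsClique U C = ∀ a b → a ∈ C → b ∈ C → a ≢ b → Adj U a b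

  IsCliqueNumber : Subset N → ℕ → Set
  IsCliqueNumber U ω =
    (∃ λ C → IsClique U C × ∣ C ∣ ≡ ω) × (∀ C → IsClique U C → ∣ C ∣ ≤ ω)

module Submission where

-- For a ≠ 0 let V a = a⁻¹U, a subspace with q^d elements; distinct vertices a, b of a clique C
-- satisfy b ∈ V a. Let C be a maximum clique with ω ≥ q^(d-1) + 2. If V a ⊈ V b for a, b ∈ C ∖ {0},
-- then V a ∩ V b is a proper subspace of V a, of size at most q^(d-1), containing C ∖ {a, b}, so
-- the two coincide. Running this for a third vertex c and then a fourth vertex w gives a
-- contradiction, except when ω = 4 = q^d. Hence all V a with a ∈ C ∖ {0} are equal, and then
-- R = {x | x · V a ⊆ U} is a subspace of V a containing C, too large to be proper. So V a = R
-- is itself a clique and ω = |V a| = q^d.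

open import Defs
open import Algebra.Bundles using (CommutativeRing)
import Algebra.Properties.CommutativeSemigroup as CommutativeSemigroupProperties
import Algebra.Properties.Ring as RingProperties
open import Data.Empty using (⊥; ⊥-elim)
open import Data.Fin.Base using (Fin; zero; suc; combine; remQuot; funToFin; finToFun)
open import Data.Fin.Properties
  using (injective⇒≤; suc-injective; any?; combine-remQuot; funToFin-finToFin; finToFun-funToFin)
  renaming (_≟_ to _≟ᶠ_)
open import Data.Fin.Subset
  using (Subset; _∈_; _∉_; _⊆_; _⊂_; _⊈_; _∩_; _-_; ⁅_⁆; ∣_∣; Nonempty; inside; outside)
open import Data.Fin.Subset.Properties
  using (_∈?_; _⊆?_; nonempty?; Empty-unique; ∣⊥∣≡0; p⊆q⇒∣p∣≤∣q∣; p⊂q⇒∣p∣<∣q∣; p─q⊆p; p─⊥≡p;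
         p∩q⊆p; x∈p∩q⁺; x∈p∩q⁻)
open import Data.List.Base using (List; []; _∷_; length)
open import Data.List.Relation.Unary.All using (All) renaming ([] to []ᴬ; _∷_ to _∷ᴬ_)
open import Data.Nat.Base as ℕ using (ℕ; _≤_; _<_; _∸_; _^_; s≤s; z≤n; >-nonZero; nonTrivial⇒n>1)
open import Data.Nat.Primality using (Prime; prime⇒nonTrivial)
open import Data.Nat.Properties
  using (≤-refl; ≤-reflexive; ≤-trans; ≤-antisym; n≤1+n; <⇒≱; ≮⇒≥; ≰⇒>; >⇒≢; m+n≤o⇒n≤o;
         +-cancelˡ-≤; *-cancelˡ-≤; +-monoʳ-≤; m≤m*n; m^n≢0; _<?_; _≤?_)
  renaming (_≟_ to _≟ℕ_)
open import Data.Product.Base using (∃; _×_; _,_; proj₁; proj₂; uncurry)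
open import Data.Product.Properties using (×-≡,≡→≡)
open import Data.Sum.Base using (_⊎_; inj₁; inj₂)
open import Data.Vec.Base using ([]; _∷_; tabulate; here; there)
open import Data.Vec.Properties using (lookup∘tabulate; lookup⇒[]=; []=⇒lookup)
open import Function.Definitions using (Injective)
open import Level using (Level)
open import Relation.Binary.PropositionalEquality
  using (_≡_; _≢_; refl; sym; trans; cong; cong₂; subst; subst₂; ≢-sym; module ≡-Reasoning)
open import Relation.Nullary using (yes; no; does; contradiction; ¬?; _×-dec_)
open import Relation.Unary using (Pred; Decidable)

-- Counting in subsets of Fin n

private
  variable
    ℓ : Level
    m n : ℕ
    p : Subset n
    x : Fin n
    xs : List (Fin n)

toSubset : {P : Pred (Fin n) ℓ} → Decidable P → Subset n
toSubset P? = tabulate (λ x → does (P? x))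

module _ {P : Pred (Fin n) ℓ} (P? : Decidable P) where

  ∈-toSubset⁺ : ∀ {x} → P x → x ∈ toSubset P?
  ∈-toSubset⁺ {x} px with P? x in eq
  ... | yes _  = lookup⇒[]= x _ (trans (lookup∘tabulate _ x) (cong does eq))
  ... | no ¬px = contradiction px ¬px

  ∈-toSubset⁻ : ∀ {x} → x ∈ toSubset P? → P x
  ∈-toSubset⁻ {x} x∈ with P? x in eq
  ... | yes px = px
  ... | no _
    with () ← trans (sym (cong does eq)) (trans (sym (lookup∘tabulate _ x)) ([]=⇒lookup x∈))

record Enumeration (p : Subset n) : Set where
  field
    element           : Fin ∣ p ∣ → Fin n
    element∈          : ∀ i → element i ∈ p
    element-injective : Injective _≡_ _≡_ element
    index             : ∀ {x} → x ∈ p → Fin ∣ p ∣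
    element-index     : ∀ {x} (x∈p : x ∈ p) → element (index x∈p) ≡ x

enumerate : (p : Subset n) → Enumeration p
enumerate [] = record
  { element = λ () ; element∈ = λ () ; element-injective = λ { {()} }
  ; index = λ () ; element-index = λ ()
  }
enumerate (outside ∷ p) = record
  { element           = λ i → suc (element i)
  ; element∈          = λ i → there (element∈ i)
  ; element-injective = λ eq → element-injective (suc-injective eq)
  ; index             = λ { (there x∈p) → index x∈p }
  ; element-index     = λ { (there x∈p) → cong suc (element-index x∈p) }
  }
  where open Enumeration (enumerate p)
enumerate (inside ∷ p) = record
  { element           = element′
  ; element∈          = λ { zero → here ; (suc i) → there (element∈ i) }
  ; element-injective = injective′
  ; index             = λ { here → zero ; (there x∈p) → suc (index x∈p) }
  ; element-index     = λ { here → refl ; (there x∈p) → cong suc (element-index x∈p) }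
  }
  where
  open Enumeration (enumerate p)
  element′ : Fin (ℕ.suc ∣ p ∣) → Fin _
  element′ zero    = zero
  element′ (suc i) = suc (element i)
  injective′ : Injective _≡_ _≡_ element′
  injective′ {zero}  {zero}  _  = refl
  injective′ {suc i} {suc j} eq = cong suc (element-injective (suc-injective eq))

module _ {p : Subset n} where

  open Enumeration (enumerate p)

  injective⇒≤∣p∣ : (f : Fin m → Fin n) → Injective _≡_ _≡_ f → (∀ i → f i ∈ p) → m ≤ ∣ p ∣
  injective⇒≤∣p∣ f f-injective f∈p = injective⇒≤ index∘f-injective
    where
    index∘f-injective : Injective _≡_ _≡_ (λ i → index (f∈p i))
    index∘f-injective {i} {j} eq = f-injective (begin
      f i                      ≡⟨ element-index (f∈p i) ⟨
      element (index (f∈p i))  ≡⟨ cong element eq ⟩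
      element (index (f∈p j))  ≡⟨ element-index (f∈p j) ⟩
      f j                      ∎)
      where open ≡-Reasoning

  bijective⇒∣p∣≡ : (f : Fin m → Fin n) → Injective _≡_ _≡_ f → (∀ i → f i ∈ p) →
                   (∀ {x} → x ∈ p → ∃ λ i → f i ≡ x) → ∣ p ∣ ≡ m
  bijective⇒∣p∣≡ f f-injective f∈p f-onto =
    ≤-antisym (injective⇒≤ preimage-injective) (injective⇒≤∣p∣ f f-injective f∈p)
    where
    preimage : Fin ∣ p ∣ → Fin _
    preimage i = proj₁ (f-onto (element∈ i))
    preimage-injective : Injective _≡_ _≡_ preimage
    preimage-injective {i} {j} eq = element-injective (begin
      element i           ≡⟨ proj₂ (f-onto (element∈ i)) ⟨
      f (preimage i)      ≡⟨ cong f eq ⟩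
      f (preimage j)      ≡⟨ proj₂ (f-onto (element∈ j)) ⟩
      element j           ∎)
      where open ≡-Reasoning

  0<∣p∣⇒Nonempty : 0 < ∣ p ∣ → Nonempty p
  0<∣p∣⇒Nonempty 0<∣p∣ with nonempty? p
  ... | yes ne = ne
  ... | no ¬ne = contradiction (trans (cong ∣_∣ (Empty-unique ¬ne)) (∣⊥∣≡0 n)) (>⇒≢ 0<∣p∣)

module _ {n′} {p : Subset n} {q : Subset n′} where

  open Enumeration (enumerate p)

  injectiveOn⇒∣p∣≤∣q∣ : (f : Fin n → Fin n′) → (∀ {x} → x ∈ p → f x ∈ q) →
                        (∀ {x y} → x ∈ p → y ∈ p → f x ≡ f y → x ≡ y) → ∣ p ∣ ≤ ∣ q ∣
  injectiveOn⇒∣p∣≤∣q∣ f f∈q f-injectiveOn = injective⇒≤∣p∣ {p = q} (λ i → f (element i))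
    (λ eq → element-injective (f-injectiveOn (element∈ _) (element∈ _) eq))
    (λ i → f∈q (element∈ i))

module _ {p q : Subset n} where

  p⊆q⇒q⊈p⇒p⊂q : p ⊆ q → q ⊈ p → p ⊂ q
  p⊆q⇒q⊈p⇒p⊂q p⊆q q⊈p with any? (λ x → (x ∈? q) ×-dec ¬? (x ∈? p))
  ... | yes (x , x∈q , x∉p) = p⊆q , x , x∈q , x∉p
  ... | no ∄ = ⊥-elim (q⊈p q⊆p)
    where
    q⊆p : q ⊆ p
    q⊆p {x} x∈q with x ∈? p
    ... | yes x∈p = x∈p
    ... | no x∉p  = contradiction (x , x∈q , x∉p) ∄

  p⊆q⇒∣q∣≤∣p∣⇒q⊆p : p ⊆ q → ∣ q ∣ ≤ ∣ p ∣ → q ⊆ p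
  p⊆q⇒∣q∣≤∣p∣⇒q⊆p p⊆q ∣q∣≤∣p∣ {x} x∈q with x ∈? p
  ... | yes x∈p = x∈p
  ... | no x∉p  = contradiction ∣q∣≤∣p∣ (<⇒≱ (p⊂q⇒∣p∣<∣q∣ (p⊆q , x , x∈q , x∉p)))

infixl 5 _─*_

_─*_ : Subset n → List (Fin n) → Subset n
p ─* []       = p
p ─* (x ∷ xs) = (p - x) ─* xs

x∉p-x : ∀ (p : Subset n) x → x ∉ p - x
x∉p-x (_ ∷ p) zero    ()
x∉p-x (_ ∷ p) (suc x) (there x∈p-x) = x∉p-x p x x∈p-x

∣p∣≤1+∣p-x∣ : ∀ (p : Subset n) x → ∣ p ∣ ≤ ℕ.suc ∣ p - x ∣
∣p∣≤1+∣p-x∣ (inside  ∷ p) zero    = s≤s (≤-reflexive (cong ∣_∣ (sym (p─⊥≡p p))))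
∣p∣≤1+∣p-x∣ (outside ∷ p) zero    = ≤-trans (≤-reflexive (cong ∣_∣ (sym (p─⊥≡p p)))) (n≤1+n _)
∣p∣≤1+∣p-x∣ (inside  ∷ p) (suc x) = s≤s (∣p∣≤1+∣p-x∣ p x)
∣p∣≤1+∣p-x∣ (outside ∷ p) (suc x) = ∣p∣≤1+∣p-x∣ p x

∈-─*⁻ : ∀ xs → x ∈ p ─* xs → x ∈ p × All (x ≢_) xs
∈-─*⁻ []       x∈p = x∈p , []ᴬ
∈-─*⁻ {x = x} {p = p} (y ∷ ys) x∈ with ∈-─*⁻ ys x∈
... | x∈p-y , x≢ys = p─q⊆p p ⁅ y ⁆ x∈p-y , (λ { refl → x∉p-x p x x∈p-y }) ∷ᴬ x≢ys

∣p∣≤∣xs∣+∣p─*xs∣ : ∀ (p : Subset n) xs → ∣ p ∣ ≤ length xs ℕ.+ ∣ p ─* xs ∣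
∣p∣≤∣xs∣+∣p─*xs∣ p []       = ≤-refl
∣p∣≤∣xs∣+∣p─*xs∣ p (x ∷ xs) = ≤-trans (∣p∣≤1+∣p-x∣ p x) (s≤s (∣p∣≤∣xs∣+∣p─*xs∣ (p - x) xs))

∣xs∣+k≤∣p∣⇒k≤∣p─*xs∣ : ∀ {k} (p : Subset n) xs → length xs ℕ.+ k ≤ ∣ p ∣ → k ≤ ∣ p ─* xs ∣
∣xs∣+k≤∣p∣⇒k≤∣p─*xs∣ p xs ∣xs∣+k≤∣p∣ =
  +-cancelˡ-≤ (length xs) _ _ (≤-trans ∣xs∣+k≤∣p∣ (∣p∣≤∣xs∣+∣p─*xs∣ p xs))

fresh : ∀ (p : Subset n) xs → length xs ℕ.+ 1 ≤ ∣ p ∣ → ∃ λ x → x ∈ p × All (x ≢_) xs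
fresh p xs ∣xs∣+1≤∣p∣ with 0<∣p∣⇒Nonempty {p = p ─* xs} (∣xs∣+k≤∣p∣⇒k≤∣p─*xs∣ p xs ∣xs∣+1≤∣p∣)
... | x , x∈ = x , ∈-─*⁻ xs x∈

funToFin-cong : ∀ {f g : Fin m → Fin n} → (∀ i → f i ≡ g i) → funToFin f ≡ funToFin g
funToFin-cong {m = ℕ.zero}  f≗g = refl
funToFin-cong {m = ℕ.suc m} f≗g = cong₂ combine (f≗g zero) (funToFin-cong (λ i → f≗g (suc i)))

finToFun-injective : ∀ {i j : Fin (n ^ m)} →
                     (∀ k → finToFun {n} {m} i k ≡ finToFun j k) → i ≡ j
finToFun-injective {n} {m} {i} {j} i≗j = begin
  i                              ≡⟨ funToFin-finToFin {m} {n} i ⟨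
  funToFin (finToFun {n} {m} i)  ≡⟨ funToFin-cong i≗j ⟩
  funToFin (finToFun {n} {m} j)  ≡⟨ funToFin-finToFin {m} {n} j ⟩
  j                              ∎
  where open ≡-Reasoning

remQuot-injective : ∀ {m} n → Injective _≡_ _≡_ (remQuot {m} n)
remQuot-injective {m} n {i} {j} eq = begin
  i                                  ≡⟨ combine-remQuot {m} n i ⟨
  uncurry combine (remQuot {m} n i)  ≡⟨ cong (uncurry combine) eq ⟩
  uncurry combine (remQuot {m} n j)  ≡⟨ combine-remQuot {m} n j ⟩
  j                                  ∎
  where open ≡-Reasoning

-- Subspaces of a finite field over a subfield

module FieldProperties {N : ℕ} (L : FiniteField N) where

  open FiniteField L

  commutativeRing : CommutativeRing _ _
  commutativeRing = record { isCommutativeRing = isCommutativeRing }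

  open CommutativeRing commutativeRing public
    using (+-assoc; +-comm; -‿inverseʳ; *-assoc; *-comm; *-identityˡ; distribˡ; zeroʳ)
  open CommutativeRing commutativeRing using (+-commutativeSemigroup; *-commutativeSemigroup; ring)
  open CommutativeSemigroupProperties +-commutativeSemigroup public using (interchange)
  open CommutativeSemigroupProperties *-commutativeSemigroup public
    using () renaming (x∙yz≈y∙xz to x*[y*z]≡y*[x*z])
  open RingProperties ring public
    using (+-cancelˡ; +-cancelʳ; +-identityˡ-unique; -‿+-comm; \\-leftDividesʳ; x∙y⁻¹≈ε⇒x≈y;
           -1*x≈-x; [y-z]x≈yx-zx)
  open ≡-Reasoning

  a+b≡c+d⇒a-c≡d-b : ∀ {a b c d} → a + b ≡ c + d → a + - c ≡ d + - b
  a+b≡c+d⇒a-c≡d-b {a} {b} {c} {d} eq = +-cancelʳ (c + b) _ _ (begin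
    (a + - c) + (c + b)    ≡⟨ +-assoc a (- c) (c + b) ⟩
    a + (- c + (c + b))    ≡⟨ cong (a +_) (\\-leftDividesʳ c b) ⟩
    a + b                  ≡⟨ eq ⟩
    c + d                  ≡⟨ +-comm c d ⟩
    d + c                  ≡⟨ cong (d +_) (\\-leftDividesʳ b c) ⟨
    d + (- b + (b + c))    ≡⟨ cong (λ t → d + (- b + t)) (+-comm b c) ⟩
    d + (- b + (c + b))    ≡⟨ +-assoc d (- b) (c + b) ⟨
    (d + - b) + (c + b)    ∎)

  [a-a′]+[b-b′]≡[a+b]-[a′+b′] : ∀ a a′ b b′ → (a + - a′) + (b + - b′) ≡ (a + b) + - (a′ + b′)
  [a-a′]+[b-b′]≡[a+b]-[a′+b′] a a′ b b′ = begin
    (a + - a′) + (b + - b′)  ≡⟨ interchange a (- a′) b (- b′) ⟩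
    (a + b) + (- a′ + - b′)  ≡⟨ cong ((a + b) +_) (-‿+-comm a′ b′) ⟩
    (a + b) + - (a′ + b′)    ∎

  inverse-cancelˡ : ∀ {a a⁻¹} x → a⁻¹ * a ≡ 1# → a⁻¹ * (a * x) ≡ x
  inverse-cancelˡ {a} {a⁻¹} x a⁻¹a≡1 = begin
    a⁻¹ * (a * x)  ≡⟨ *-assoc a⁻¹ a x ⟨
    (a⁻¹ * a) * x  ≡⟨ cong (_* x) a⁻¹a≡1 ⟩
    1# * x         ≡⟨ *-identityˡ x ⟩
    x              ∎

  *-cancelˡ : ∀ {a a⁻¹ x y} → a⁻¹ * a ≡ 1# → a * x ≡ a * y → x ≡ y
  *-cancelˡ {a} {a⁻¹} {x} {y} a⁻¹a≡1 ax≡ay = begin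
    x              ≡⟨ inverse-cancelˡ x a⁻¹a≡1 ⟨
    a⁻¹ * (a * x)  ≡⟨ cong (a⁻¹ *_) ax≡ay ⟩
    a⁻¹ * (a * y)  ≡⟨ inverse-cancelˡ y a⁻¹a≡1 ⟩
    y              ∎

  inverseˡ : ∀ x → x ≢ 0# → ∃ λ x⁻¹ → x⁻¹ * x ≡ 1#
  inverseˡ x x≢0 with inverse x x≢0
  ... | x⁻¹ , xx⁻¹≡1 = x⁻¹ , trans (*-comm x⁻¹ x) xx⁻¹≡1

  lincomb-cong : ∀ d {c c′} b → (∀ i → c i ≡ c′ i) → lincomb L d c b ≡ lincomb L d c′ b
  lincomb-cong ℕ.zero    b c≗c′ = refl
  lincomb-cong (ℕ.suc d) b c≗c′ =
    cong₂ (λ c₀ s → c₀ * b zero + s) (c≗c′ zero)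
          (lincomb-cong d (λ i → b (suc i)) (λ i → c≗c′ (suc i)))

  lincomb-difference : ∀ d c c′ b →
    lincomb L d (λ i → c i + - c′ i) b ≡ lincomb L d c b + - lincomb L d c′ b
  lincomb-difference ℕ.zero    c c′ b = sym (-‿inverseʳ 0#)
  lincomb-difference (ℕ.suc d) c c′ b = begin
    (c zero + - c′ zero) * b zero + lincomb L d (λ i → c (suc i) + - c′ (suc i)) b′
      ≡⟨ cong₂ _+_ ([y-z]x≈yx-zx (b zero) (c zero) (c′ zero)) (lincomb-difference d _ _ b′) ⟩
    (c zero * b zero + - (c′ zero * b zero)) + (lincomb L d _ b′ + - lincomb L d _ b′)
      ≡⟨ [a-a′]+[b-b′]≡[a+b]-[a′+b′] _ _ _ _ ⟩
    lincomb L (ℕ.suc d) c b + - lincomb L (ℕ.suc d) c′ b ∎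
    where
    b′ : Fin d → Fin N
    b′ i = b (suc i)

module Subspaces {N : ℕ} {L : FiniteField N} {K : Subset N} (isK : IsSubfield L K) where

  open FiniteField L
  open FieldProperties L
  private module K = IsSubfield isK

  module _ {W : Subset N} (isW : IsSubspace L K W) where

    open IsSubspace isW

    neg-closed : ∀ {x} → x ∈ W → - x ∈ W
    neg-closed {x} x∈W = subst (_∈ W) (-1*x≈-x x) (smul-closed (K.neg-closed K.1∈K) x∈W)

    smul-cancel : ∀ {c x} → c ∈ K → c ≢ 0# → c * x ∈ W → x ∈ W
    smul-cancel {c} {x} c∈K c≢0 cx∈W with inverse c c≢0
    ... | c⁻¹ , cc⁻¹≡1 = subst (_∈ W) (inverse-cancelˡ x (trans (*-comm c⁻¹ c) cc⁻¹≡1))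
                                       (smul-closed (K.inv-closed c∈K cc⁻¹≡1) cx∈W)

  ∩-isSubspace : ∀ {X Y} → IsSubspace L K X → IsSubspace L K Y → IsSubspace L K (X ∩ Y)
  ∩-isSubspace {X} {Y} isX isY = record
    { 0∈U         = x∈p∩q⁺ (X.0∈U , Y.0∈U)
    ; +-closed    = λ x∈ y∈ → x∈p∩q⁺ ( X.+-closed (proj₁ (x∈p∩q⁻ X Y x∈)) (proj₁ (x∈p∩q⁻ X Y y∈))
                                    , Y.+-closed (proj₂ (x∈p∩q⁻ X Y x∈)) (proj₂ (x∈p∩q⁻ X Y y∈)))
    ; smul-closed = λ c∈K x∈ → x∈p∩q⁺ ( X.smul-closed c∈K (proj₁ (x∈p∩q⁻ X Y x∈))
                                      , Y.smul-closed c∈K (proj₂ (x∈p∩q⁻ X Y x∈)))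
    }
    where
    module X = IsSubspace isX
    module Y = IsSubspace isY

  module _ {X : Subset N} (isX : IsSubspace L K X) {y : Fin N} (y∉X : y ∉ X) where

    *y+-injective : ∀ {k k′ x x′} → k ∈ K → k′ ∈ K → x ∈ X → x′ ∈ X →
                    k * y + x ≡ k′ * y + x′ → k ≡ k′ × x ≡ x′
    *y+-injective {k} {k′} {x} {x′} k∈K k′∈K x∈X x′∈X eq with k ≟ᶠ k′
    ... | yes refl = refl , +-cancelˡ (k * y) x x′ eq
    ... | no k≢k′  = contradiction (smul-cancel isX k-k′∈K k-k′≢0 [k-k′]y∈X) y∉X
      where
      k-k′∈K : k + - k′ ∈ K
      k-k′∈K = K.+-closed k∈K (K.neg-closed k′∈K)
      k-k′≢0 : k + - k′ ≢ 0#
      k-k′≢0 k-k′≡0 = k≢k′ (x∙y⁻¹≈ε⇒x≈y k k′ k-k′≡0)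
      [k-k′]y∈X : (k + - k′) * y ∈ X
      [k-k′]y∈X = subst (_∈ X) (sym (trans ([y-z]x≈yx-zx y k k′) (a+b≡c+d⇒a-c≡d-b eq)))
                         (IsSubspace.+-closed isX x′∈X (neg-closed isX x∈X))

  ⊂⇒∣K∣*∣X∣≤∣Y∣ : ∀ {X Y} → IsSubspace L K X → IsSubspace L K Y → X ⊂ Y → ∣ K ∣ ℕ.* ∣ X ∣ ≤ ∣ Y ∣
  ⊂⇒∣K∣*∣X∣≤∣Y∣ {X} {Y} isX isY (X⊆Y , y , y∈Y , y∉X) = injective⇒≤∣p∣ f f-injective f∈Y
    where
    module EK = Enumeration (enumerate K)
    module EX = Enumeration (enumerate X)
    module Y = IsSubspace isY
    f : Fin (∣ K ∣ ℕ.* ∣ X ∣) → Fin N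
    f i = let (k , x) = remQuot ∣ X ∣ i in EK.element k * y + EX.element x
    f∈Y : ∀ i → f i ∈ Y
    f∈Y i = Y.+-closed (Y.smul-closed (EK.element∈ _) y∈Y) (X⊆Y (EX.element∈ _))
    f-injective : Injective _≡_ _≡_ f
    f-injective {i} {j} eq with *y+-injective isX y∉X (EK.element∈ _) (EK.element∈ _)
                                               (EX.element∈ _) (EX.element∈ _) eq
    ... | k≡k′ , x≡x′ = remQuot-injective ∣ X ∣
                          (×-≡,≡→≡ (EK.element-injective k≡k′ , EX.element-injective x≡x′))

  lincomb-closed : ∀ {W} → IsSubspace L K W → ∀ d {c b} →
                   (∀ i → c i ∈ K) → (∀ i → b i ∈ W) → lincomb L d c b ∈ W
  lincomb-closed isW ℕ.zero    c∈K b∈W = IsSubspace.0∈U isW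
  lincomb-closed isW (ℕ.suc d) c∈K b∈W =
    IsSubspace.+-closed isW (IsSubspace.smul-closed isW (c∈K zero) (b∈W zero))
                            (lincomb-closed isW d (λ i → c∈K (suc i)) (λ i → b∈W (suc i)))

  ∣U∣≡∣K∣^d : ∀ {U d b} → IsSubspace L K U → IsBasis L K U d b → ∣ U ∣ ≡ ∣ K ∣ ^ d
  ∣U∣≡∣K∣^d {U} {d} {b} isU isB =
    bijective⇒∣p∣≡ combination combination-injective combination∈U combination-onto
    where
    open IsBasis isB
    open Enumeration (enumerate K)
    coefficients : Fin (∣ K ∣ ^ d) → Fin d → Fin N
    coefficients i j = element (finToFun i j)
    combination : Fin (∣ K ∣ ^ d) → Fin N
    combination i = lincomb L d (coefficients i) b
    combination∈U : ∀ i → combination i ∈ U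
    combination∈U i = lincomb-closed isU d (λ j → element∈ _) in-U
    combination-injective : Injective _≡_ _≡_ combination
    combination-injective {i} {i′} eq = finToFun-injective λ j →
      element-injective (x∙y⁻¹≈ε⇒x≈y _ _ (independent _ difference∈K difference≡0 j))
      where
      difference∈K : ∀ j → coefficients i j + - coefficients i′ j ∈ K
      difference∈K j = K.+-closed (element∈ _) (K.neg-closed (element∈ _))
      difference≡0 : lincomb L d (λ j → coefficients i j + - coefficients i′ j) b ≡ 0#
      difference≡0 = trans (lincomb-difference d _ _ b)
                           (trans (cong (_+ - combination i′) eq) (-‿inverseʳ (combination i′)))
    combination-onto : ∀ {u} → u ∈ U → ∃ λ i → combination i ≡ u
    combination-onto u∈U with spanning _ u∈U
    ... | c , c∈K , u≡∑cb =
      funToFin (λ j → index (c∈K j)) , trans (lincomb-cong d b coefficient≡) (sym u≡∑cb)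
      where
      coefficient≡ : ∀ j → coefficients (funToFin (λ j → index (c∈K j))) j ≡ c j
      coefficient≡ j = trans (cong element (finToFun-funToFin _ j)) (element-index (c∈K j))

  infix 8 _⁻¹·_

  -- For a ≢ 0# this is a⁻¹W; for a = 0# it is all of L as soon as 0# ∈ W.

  _⁻¹·_ : Fin N → Subset N → Subset N
  a ⁻¹· W = toSubset (λ z → a * z ∈? W)

  module _ {a : Fin N} {W : Subset N} where

    ∈-⁻¹·⁺ : ∀ {z} → a * z ∈ W → z ∈ a ⁻¹· W
    ∈-⁻¹·⁺ = ∈-toSubset⁺ (λ z → a * z ∈? W)

    ∈-⁻¹·⁻ : ∀ {z} → z ∈ a ⁻¹· W → a * z ∈ W
    ∈-⁻¹·⁻ = ∈-toSubset⁻ (λ z → a * z ∈? W)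

    ∈-⁻¹·-comm : ∀ {z} → z ∈ a ⁻¹· W → a ∈ z ⁻¹· W
    ∈-⁻¹·-comm {z} z∈ = ∈-toSubset⁺ (λ x → z * x ∈? W) (subst (_∈ W) (*-comm a z) (∈-⁻¹·⁻ z∈))

    ⁻¹·-isSubspace : IsSubspace L K W → IsSubspace L K (a ⁻¹· W)
    ⁻¹·-isSubspace isW = record
      { 0∈U         = ∈-⁻¹·⁺ (subst (_∈ W) (sym (zeroʳ a)) W.0∈U)
      ; +-closed    = λ x∈ y∈ → ∈-⁻¹·⁺ (subst (_∈ W) (sym (distribˡ a _ _))
                                          (W.+-closed (∈-⁻¹·⁻ x∈) (∈-⁻¹·⁻ y∈)))
      ; smul-closed = λ c∈K x∈ → ∈-⁻¹·⁺ (subst (_∈ W) (x*[y*z]≡y*[x*z] _ _ _)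
                                           (W.smul-closed c∈K (∈-⁻¹·⁻ x∈)))
      }
      where module W = IsSubspace isW

    ∣a⁻¹·W∣≡∣W∣ : a ≢ 0# → ∣ a ⁻¹· W ∣ ≡ ∣ W ∣
    ∣a⁻¹·W∣≡∣W∣ a≢0 with inverseˡ a a≢0
    ... | a⁻¹ , a⁻¹a≡1 = ≤-antisym
      (injectiveOn⇒∣p∣≤∣q∣ (a *_) ∈-⁻¹·⁻ (λ _ _ → *-cancelˡ a⁻¹a≡1))
      (injectiveOn⇒∣p∣≤∣q∣ (a⁻¹ *_)
        (λ {x} x∈W → ∈-⁻¹·⁺ (subst (_∈ W) (sym (inverse-cancelˡ x aa⁻¹≡1)) x∈W))
        (λ _ _ → *-cancelˡ aa⁻¹≡1))
      where
      aa⁻¹≡1 : a * a⁻¹ ≡ 1#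
      aa⁻¹≡1 = trans (*-comm a a⁻¹) a⁻¹a≡1

-- Maximum cliques of G_U

c≤4⇒c≡m*D : ∀ {m D c} → 2 ≤ m → m ≤ D → 2 ℕ.+ D ≤ c → c ≤ 4 → c ≡ m ℕ.* D
c≤4⇒c≡m*D {m} {D} {c} 2≤m m≤D 2+D≤c c≤4 =
  trans (≤-antisym c≤4 (subst (λ t → 2 ℕ.+ t ≤ c) D≡2 2+D≤c)) (sym (cong₂ ℕ._*_ m≡2 D≡2))
  where
  D≤2 : D ≤ 2
  D≤2 = +-cancelˡ-≤ 2 D 2 (≤-trans 2+D≤c c≤4)
  D≡2 : D ≡ 2
  D≡2 = ≤-antisym D≤2 (≤-trans 2≤m m≤D)
  m≡2 : m ≡ 2
  m≡2 = ≤-antisym (≤-trans m≤D D≤2) 2≤m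

module LargeCliques
  {N : ℕ} {L : FiniteField N} {K : Subset N} (isK : IsSubfield L K)
  {U : Subset N} (isU : IsSubspace L K U)
  (D : ℕ) (∣U∣≡∣K∣*D : ∣ U ∣ ≡ ∣ K ∣ ℕ.* D) (2≤∣K∣ : 2 ≤ ∣ K ∣) (∣K∣≤D : ∣ K ∣ ≤ D)
  {C : Subset N} (C-clique : IsClique L U C) (C-maximum : ∀ C′ → IsClique L U C′ → ∣ C′ ∣ ≤ ∣ C ∣)
  (C-large : 2 ℕ.+ D ≤ ∣ C ∣)
  where

  open FiniteField L
  open FieldProperties L using (+-identityˡ-unique; \\-leftDividesʳ)
  open Subspaces isK

  V : Fin N → Subset N
  V a = a ⁻¹· U

  V-isSubspace : ∀ a → IsSubspace L K (V a)
  V-isSubspace a = ⁻¹·-isSubspace isU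

  ∣Va∣≡∣K∣*D : ∀ {a} → a ≢ 0# → ∣ V a ∣ ≡ ∣ K ∣ ℕ.* D
  ∣Va∣≡∣K∣*D a≢0 = trans (∣a⁻¹·W∣≡∣W∣ a≢0) ∣U∣≡∣K∣*D

  ⊂Va⇒∣X∣≤D : ∀ {a X} → a ≢ 0# → IsSubspace L K X → X ⊂ V a → ∣ X ∣ ≤ D
  ⊂Va⇒∣X∣≤D {a} a≢0 isX X⊂Va = *-cancelˡ-≤ ∣ K ∣ {{>-nonZero (≤-trans (s≤s z≤n) 2≤∣K∣)}}
    (≤-trans (⊂⇒∣K∣*∣X∣≤∣Y∣ isX (V-isSubspace a) X⊂Va) (≤-reflexive (∣Va∣≡∣K∣*D a≢0)))

  Va⊆Vb⇒Vb⊆Va : ∀ {a b} → a ≢ 0# → b ≢ 0# → V a ⊆ V b → V b ⊆ V a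
  Va⊆Vb⇒Vb⊆Va a≢0 b≢0 Va⊆Vb =
    p⊆q⇒∣q∣≤∣p∣⇒q⊆p Va⊆Vb (≤-reflexive (trans (∣Va∣≡∣K∣*D b≢0) (sym (∣Va∣≡∣K∣*D a≢0))))

  adjacent : ∀ {x y} → x ∈ C → y ∈ C → x ≢ y → y ∈ V x
  adjacent x∈C y∈C x≢y = ∈-⁻¹·⁺ (proj₂ (C-clique _ _ x∈C y∈C x≢y))

  Va∩Vb⊆C : ∀ {a b} → a ∈ C → b ∈ C → a ≢ 0# → a ≢ b → V a ⊈ V b →
            ∀ {x} → x ∈ V a ∩ V b → x ∈ C × x ≢ a × x ≢ b
  Va∩Vb⊆C {a} {b} a∈C b∈C a≢0 a≢b Va⊈Vb {x} x∈Va∩Vb =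
    unpack (∈-─*⁻ (a ∷ b ∷ []) (p⊆q⇒∣q∣≤∣p∣⇒q⊆p C-ab⊆Va∩Vb (≤-trans ∣Va∩Vb∣≤D D≤∣C-ab∣) x∈Va∩Vb))
    where
    unpack : x ∈ C × All (x ≢_) (a ∷ b ∷ []) → x ∈ C × x ≢ a × x ≢ b
    unpack (x∈C , x≢a ∷ᴬ x≢b ∷ᴬ []ᴬ) = x∈C , x≢a , x≢b
    Va∩Vb⊂Va : V a ∩ V b ⊂ V a
    Va∩Vb⊂Va = p⊆q⇒q⊈p⇒p⊂q (p∩q⊆p (V a) (V b))
                 (λ Va⊆Va∩Vb → Va⊈Vb (λ z∈Va → proj₂ (x∈p∩q⁻ (V a) (V b) (Va⊆Va∩Vb z∈Va))))
    ∣Va∩Vb∣≤D : ∣ V a ∩ V b ∣ ≤ D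
    ∣Va∩Vb∣≤D = ⊂Va⇒∣X∣≤D a≢0 (∩-isSubspace (V-isSubspace a) (V-isSubspace b)) Va∩Vb⊂Va
    C-ab⊆Va∩Vb : C ─* (a ∷ b ∷ []) ⊆ V a ∩ V b
    C-ab⊆Va∩Vb z∈ with ∈-─*⁻ (a ∷ b ∷ []) z∈
    ... | z∈C , z≢a ∷ᴬ z≢b ∷ᴬ []ᴬ =
      x∈p∩q⁺ (adjacent a∈C z∈C (≢-sym z≢a) , adjacent b∈C z∈C (≢-sym z≢b))
    D≤∣C-ab∣ : D ≤ ∣ C ─* (a ∷ b ∷ []) ∣
    D≤∣C-ab∣ = ∣xs∣+k≤∣p∣⇒k≤∣p─*xs∣ C (a ∷ b ∷ []) C-large

  Va⊈Vb⇒a∉Va : ∀ {a b} → a ∈ C → b ∈ C → a ≢ 0# → a ≢ b → V a ⊈ V b → a ∉ V a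
  Va⊈Vb⇒a∉Va {a} {b} a∈C b∈C a≢0 a≢b Va⊈Vb a∈Va =
    proj₁ (proj₂ (Va∩Vb⊆C a∈C b∈C a≢0 a≢b Va⊈Vb a∈Va∩Vb)) refl
    where
    a∈Va∩Vb : a ∈ V a ∩ V b
    a∈Va∩Vb = x∈p∩q⁺ (a∈Va , adjacent b∈C a∈C (≢-sym a≢b))

  a∉Va⇒Va⊈Vc : ∀ {a c} → a ∈ C → c ∈ C → a ≢ 0# → c ≢ 0# → c ≢ a → a ∉ V a → V a ⊈ V c
  a∉Va⇒Va⊈Vc a∈C c∈C a≢0 c≢0 c≢a a∉Va Va⊆Vc =
    a∉Va (Va⊆Vb⇒Vb⊆Va a≢0 c≢0 Va⊆Vc (adjacent c∈C a∈C c≢a))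

  -- w + b ∈ V a ∩ V c ⊆ C is adjacent to b, so b = (w + b) - w ∈ V a ∩ V b, which avoids b.
  no-fourth-point : ∀ {a b c w} → a ∈ C → b ∈ C → c ∈ C → w ∈ C → a ≢ 0# → a ≢ b → a ≢ c → b ≢ c →
                    w ≢ 0# → w ≢ a → w ≢ b → w ≢ c → V a ⊈ V b → V a ⊈ V c → ⊥
  no-fourth-point {a} {b} {c} {w} a∈C b∈C c∈C w∈C a≢0 a≢b a≢c b≢c w≢0 w≢a w≢b w≢c Va⊈Vb Va⊈Vc =
    proj₂ (proj₂ (Va∩Vb⊆C a∈C b∈C a≢0 a≢b Va⊈Vb b∈Va∩Vb)) refl
    where
    Va∩Vb-isSubspace : IsSubspace L K (V a ∩ V b)
    Va∩Vb-isSubspace = ∩-isSubspace (V-isSubspace a) (V-isSubspace b)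
    module Va = IsSubspace (V-isSubspace a)
    module Vc = IsSubspace (V-isSubspace c)
    module Va∩Vb = IsSubspace Va∩Vb-isSubspace
    w+b∈Va∩Vc : w + b ∈ V a ∩ V c
    w+b∈Va∩Vc = x∈p∩q⁺ ( Va.+-closed (adjacent a∈C w∈C (≢-sym w≢a)) (adjacent a∈C b∈C a≢b)
                       , Vc.+-closed (adjacent c∈C w∈C (≢-sym w≢c)) (adjacent c∈C b∈C (≢-sym b≢c)))
    w+b∈C : w + b ∈ C
    w+b∈C = proj₁ (Va∩Vb⊆C a∈C c∈C a≢0 a≢c Va⊈Vc w+b∈Va∩Vc)
    w+b≢b : w + b ≢ b
    w+b≢b w+b≡b = w≢0 (+-identityˡ-unique w b w+b≡b)
    w∈Va∩Vb : w ∈ V a ∩ V b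
    w∈Va∩Vb = x∈p∩q⁺ (adjacent a∈C w∈C (≢-sym w≢a) , adjacent b∈C w∈C (≢-sym w≢b))
    w+b∈Va∩Vb : w + b ∈ V a ∩ V b
    w+b∈Va∩Vb = x∈p∩q⁺ (proj₁ (x∈p∩q⁻ (V a) (V c) w+b∈Va∩Vc) , adjacent b∈C w+b∈C (≢-sym w+b≢b))
    b∈Va∩Vb : b ∈ V a ∩ V b
    b∈Va∩Vb = subst (_∈ V a ∩ V b) (\\-leftDividesʳ w b)
                    (Va∩Vb.+-closed (neg-closed Va∩Vb-isSubspace w∈Va∩Vb) w+b∈Va∩Vb)

  4≤∣C∣ : 4 ≤ ∣ C ∣
  4≤∣C∣ = ≤-trans (+-monoʳ-≤ 2 (≤-trans 2≤∣K∣ ∣K∣≤D)) C-large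

  Coincide : Set
  Coincide = ∀ {a b} → a ∈ C → b ∈ C → a ≢ 0# → b ≢ 0# → a ≢ b → V a ⊆ V b

  ∣C∣≢∣K∣*D⇒coincide : ∣ C ∣ ≢ ∣ K ∣ ℕ.* D → Coincide
  ∣C∣≢∣K∣*D⇒coincide ∣C∣≢∣K∣*D {a} {b} a∈C b∈C a≢0 b≢0 a≢b with V a ⊆? V b
  ... | yes Va⊆Vb = Va⊆Vb
  ... | no Va⊈Vb with fresh C (0# ∷ a ∷ b ∷ []) 4≤∣C∣
  ...   | c , c∈C , c≢0 ∷ᴬ c≢a ∷ᴬ c≢b ∷ᴬ []ᴬ with 4 <? ∣ C ∣
  -- Without a fourth vertex, |C| = 4 = |U| (the case q = d = 2).
  ...     | no 4≮∣C∣ = contradiction (c≤4⇒c≡m*D 2≤∣K∣ ∣K∣≤D C-large (≮⇒≥ 4≮∣C∣)) ∣C∣≢∣K∣*D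
  ...     | yes 4<∣C∣ with fresh C (0# ∷ a ∷ b ∷ c ∷ []) 4<∣C∣
  ...       | w , w∈C , w≢0 ∷ᴬ w≢a ∷ᴬ w≢b ∷ᴬ w≢c ∷ᴬ []ᴬ =
    ⊥-elim (no-fourth-point a∈C b∈C c∈C w∈C a≢0 a≢b (≢-sym c≢a) (≢-sym c≢b) w≢0 w≢a w≢b w≢c Va⊈Vb
              (a∉Va⇒Va⊈Vc a∈C c∈C a≢0 c≢0 c≢a (Va⊈Vb⇒a∉Va a∈C b∈C a≢0 a≢b Va⊈Vb)))

  -- R = {x | x · V a ⊆ U} is a subspace of V a containing C, hence too large to be proper.
  coincide⇒∣C∣≡∣Va∣ : Coincide → ∀ {a b} → a ∈ C → b ∈ C → a ≢ 0# → b ≢ 0# → b ≢ a → ∣ C ∣ ≡ ∣ V a ∣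
  coincide⇒∣C∣≡∣Va∣ coincide {a} a∈C b∈C a≢0 b≢0 b≢a =
    ≤-antisym (≤-trans (p⊆q⇒∣p∣≤∣q∣ C⊆R) (p⊆q⇒∣p∣≤∣q∣ R⊆Va)) (C-maximum (V a) Va-clique)
    where
    R : Subset N
    R = toSubset (λ x → V a ⊆? V x)
    R⁺ : ∀ {x} → V a ⊆ V x → x ∈ R
    R⁺ = ∈-toSubset⁺ (λ x → V a ⊆? V x)
    R⁻ : ∀ {x} → x ∈ R → V a ⊆ V x
    R⁻ = ∈-toSubset⁻ (λ x → V a ⊆? V x)
    R-isSubspace : IsSubspace L K R
    R-isSubspace = record
      { 0∈U         = R⁺ λ z∈Va → ∈-⁻¹·-comm (IsSubspace.0∈U (V-isSubspace _))
      ; +-closed    = λ x∈R y∈R → R⁺ λ z∈Va → ∈-⁻¹·-comm (IsSubspace.+-closed (V-isSubspace _)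
                                   (∈-⁻¹·-comm (R⁻ x∈R z∈Va)) (∈-⁻¹·-comm (R⁻ y∈R z∈Va)))
      ; smul-closed = λ c∈K x∈R → R⁺ λ z∈Va → ∈-⁻¹·-comm (IsSubspace.smul-closed (V-isSubspace _)
                                     c∈K (∈-⁻¹·-comm (R⁻ x∈R z∈Va)))
      }
    a∈Va : a ∈ V a
    a∈Va = coincide b∈C a∈C b≢0 a≢0 b≢a (adjacent b∈C a∈C b≢a)
    R⊆Va : R ⊆ V a
    R⊆Va x∈R = ∈-⁻¹·-comm (R⁻ x∈R a∈Va)
    C⊆R : C ⊆ R
    C⊆R {c} c∈C with c ≟ᶠ 0# | c ≟ᶠ a
    ... | yes refl | _        = IsSubspace.0∈U R-isSubspace
    ... | no c≢0   | yes refl = R⁺ λ z∈Va → z∈Va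
    ... | no c≢0   | no c≢a   = R⁺ (coincide a∈C c∈C a≢0 c≢0 (≢-sym c≢a))
    D<∣R∣ : D < ∣ R ∣
    D<∣R∣ = ≤-trans (n≤1+n _) (≤-trans C-large (p⊆q⇒∣p∣≤∣q∣ C⊆R))
    Va⊆R : V a ⊆ R
    Va⊆R {x} x∈Va with V a ⊆? R
    ... | yes Va⊆R = Va⊆R x∈Va
    ... | no Va⊈R  = contradiction (⊂Va⇒∣X∣≤D a≢0 R-isSubspace (p⊆q⇒q⊈p⇒p⊂q R⊆Va Va⊈R)) (<⇒≱ D<∣R∣)
    Va-clique : IsClique L U (V a)
    Va-clique x y x∈Va y∈Va x≢y = x≢y , ∈-⁻¹·⁻ (R⁻ (Va⊆R x∈Va) y∈Va)

  ∣C∣≡∣K∣*D : ∣ C ∣ ≡ ∣ K ∣ ℕ.* D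
  ∣C∣≡∣K∣*D with ∣ C ∣ ≟ℕ ∣ K ∣ ℕ.* D
  ... | yes ∣C∣≡∣K∣*D = ∣C∣≡∣K∣*D
  ... | no ∣C∣≢∣K∣*D with fresh C (0# ∷ []) (m+n≤o⇒n≤o 2 4≤∣C∣)
  ...   | a , a∈C , a≢0 ∷ᴬ []ᴬ with fresh C (0# ∷ a ∷ []) (m+n≤o⇒n≤o 1 4≤∣C∣)
  ...     | b , b∈C , b≢0 ∷ᴬ b≢a ∷ᴬ []ᴬ =
    trans (coincide⇒∣C∣≡∣Va∣ (∣C∣≢∣K∣*D⇒coincide ∣C∣≢∣K∣*D) a∈C b∈C a≢0 b≢0 b≢a) (∣Va∣≡∣K∣*D a≢0)

-- Imported only here: above, they would clash with the field's _+_ and +-comm.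
open import Data.Nat.Base using (_+_)
open import Data.Nat.Properties using (+-comm)

module _ {N : ℕ} {L : FiniteField N} {K : Subset N} (isK : IsSubfield L K) (2≤∣K∣ : 2 ≤ ∣ K ∣)
         {U : Subset N} (isU : IsSubspace L K U) where

  open Subspaces isK using (∣U∣≡∣K∣^d)

  cliqueNumber-dichotomy : ∀ {d ω} → HasDim L K U d → 2 ≤ d → IsCliqueNumber L U ω →
                           ω ≡ ∣ K ∣ ^ d ⊎ ω ≤ ∣ K ∣ ^ (d ∸ 1) + 1
  cliqueNumber-dichotomy {ℕ.suc (ℕ.suc e)} {ω} (b , isB) (s≤s (s≤s z≤n))
                         ((C , C-clique , ∣C∣≡ω) , C-maximum)
    with ω ≤? ∣ K ∣ ^ ℕ.suc e + 1
  ... | yes ω≤D+1 = inj₂ ω≤D+1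
  ... | no ω≰D+1 = inj₁ (trans (sym ∣C∣≡ω) (LargeCliques.∣C∣≡∣K∣*D isK isU D
                          (∣U∣≡∣K∣^d isU isB) 2≤∣K∣ ∣K∣≤D C-clique C-maximal C-large))
    where
    D : ℕ
    D = ∣ K ∣ ^ ℕ.suc e
    ∣K∣≤D : ∣ K ∣ ≤ D
    ∣K∣≤D = m≤m*n ∣ K ∣ (∣ K ∣ ^ e) {{m^n≢0 ∣ K ∣ e {{>-nonZero (≤-trans (s≤s z≤n) 2≤∣K∣)}}}}
    C-maximal : ∀ C′ → IsClique L U C′ → ∣ C′ ∣ ≤ ∣ C ∣
    C-maximal C′ C′-clique = subst (∣ C′ ∣ ≤_) (sym ∣C∣≡ω) (C-maximum C′ C′-clique)
    C-large : 2 ℕ.+ D ≤ ∣ C ∣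
    C-large = subst₂ _≤_ (cong ℕ.suc (+-comm D 1)) (sym ∣C∣≡ω) (≰⇒> ω≰D+1)

2≤primePower : ∀ {q} → (∃ λ p → ∃ λ k → Prime p × 1 ≤ k × q ≡ p ^ k) → 2 ≤ q
2≤primePower (p , ℕ.suc k , p-prime , _ , refl) =
  ≤-trans p>1 (m≤m*n p (p ^ k) {{m^n≢0 p k {{>-nonZero (≤-trans (s≤s z≤n) p>1)}}}})
  where
  p>1 : 2 ≤ p
  p>1 = nonTrivial⇒n>1 p {{prime⇒nonTrivial p-prime}}

corollary3p2 :
    (q n : ℕ) →
    (∃ λ p → ∃ λ k → Prime p × 1 ≤ k × q ≡ p ^ k) →
    2 ≤ n →
    (L : FiniteField (q ^ n)) →
    (K : Subset (q ^ n)) → IsSubfield L K → ∣ K ∣ ≡ q →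
    (U : Subset (q ^ n)) → IsSubspace L K U → (∃ λ x → x ∉ U) →
    (d : ℕ) → HasDim L K U d → 2 ≤ d →
    (ω : ℕ) → IsCliqueNumber L U ω →
    ω ≡ q ^ d ⊎ ω ≤ q ^ (d ∸ 1) + 1
corollary3p2 q n q-primePower _ L K isK ∣K∣≡q U isU _ d dimU 2≤d ω isω =
  subst (λ m → ω ≡ m ^ d ⊎ ω ≤ m ^ (d ∸ 1) + 1) ∣K∣≡q
    (cliqueNumber-dichotomy isK 2≤∣K∣ isU dimU 2≤d isω)
  where
  2≤∣K∣ : 2 ≤ ∣ K ∣
  2≤∣K∣ = subst (2 ≤_) (sym ∣K∣≡q) (2≤primePower q-primePower)
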